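{- Let $H$ be a graph of order $n\geq 8$ with minimum degree $\delta(H)\geq n-4$. Then either $H$ contains both $S_n[4]$ and $T_A(n)$ as subgraphs, or $n\equiv 0\pmod 4$ and the complement $\overline{H}$ is the disjoint union of $n/4$ copies of $K_4$.
   Context: Graphs are finite and simple. $S_k$ is the star of order $k$. $S_n[4]$ is the tree of order $n$ obtained by adding an edge joining the center of $S_{n-4}$ to a degree-one vertex of $S_4$. $T_A(n)$ is the tree of order $n$ consisting of a vertex $c$ adjacent to $n-5$ leaves and to a vertex $x$, where $x$ is adjacent to two further vertices $y$ and $z$, and $y$ is adjacent to one further leaf $w$. -}

module Defs where

open import Data.Nat using (ℕ; zero; suc; _+_; _*_; _/_; _%_; _≤_; _∸_)
open import Data.Bool using (Bool; true; false; _∨_; _∧_; not; if_then_else_)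
open import Data.Bool.Properties using (∨-comm)
open import Data.Fin using (Fin; toℕ)
open import Data.List using (List; map; allFin)
open import Data.Nat.ListAction using (sum)
open import Data.Product using (Σ; _×_; _,_)
open import Relation.Binary.PropositionalEquality using (_≡_; refl)
open import Relation.Nullary using (¬_)
open import Relation.Nullary.Decidable using (⌊_⌋)
open import Function.Bundles using (_↔_; Inverse)
open import Data.Nat.Properties using () renaming (_≟_ to _≟ℕ_)

record Graph (n : ℕ) : Set where
  field
    adj    : Fin n → Fin n → Bool
    sym    : ∀ u v → adj u v ≡ adj v u
    irrefl : ∀ v → adj v v ≡ false
open Graph public

deg : ∀ {n} → Graph n → Fin n → ℕ
deg {n} G v = sum (map (λ u → if adj G v u then 1 else 0) (allFin n))

minDeg≥ : ∀ {n} → Graph n → ℕ → Set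
minDeg≥ G d = ∀ v → d ≤ deg G v

_⊆G_ : ∀ {m n} → Graph m → Graph n → Set
_⊆G_ {m} {n} G H =
  Σ (Fin m → Fin n) λ f →
    (∀ u v → f u ≡ f v → u ≡ v) ×
    (∀ u v → adj G u v ≡ true → adj H (f u) (f v) ≡ true)

_≅_ : ∀ {m n} → Graph m → Graph n → Set
_≅_ {m} {n} G H =
  Σ (Fin m ↔ Fin n) λ φ → ∀ u v → adj H (Inverse.to φ u) (Inverse.to φ v) ≡ adj G u v

neqF : ∀ {n} → Fin n → Fin n → Bool
neqF u v = not ⌊ toℕ u ≟ℕ toℕ v ⌋

neqF-sym : ∀ {n} (u v : Fin n) → neqF u v ≡ neqF v u
neqF-sym u v with toℕ u ≟ℕ toℕ v | toℕ v ≟ℕ toℕ u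
... | Relation.Nullary.yes _ | Relation.Nullary.yes _ = refl
... | Relation.Nullary.no _  | Relation.Nullary.no _  = refl
... | Relation.Nullary.yes p | Relation.Nullary.no q = Data.Empty.⊥-elim (q (Relation.Binary.PropositionalEquality.sym p))
  where import Data.Empty
... | Relation.Nullary.no q | Relation.Nullary.yes p = Data.Empty.⊥-elim (q (Relation.Binary.PropositionalEquality.sym p))
  where import Data.Empty

neqF-irr : ∀ {n} (u : Fin n) → neqF u u ≡ false
neqF-irr u with toℕ u ≟ℕ toℕ u
... | Relation.Nullary.yes _ = refl
... | Relation.Nullary.no q = Data.Empty.⊥-elim (q refl)
  where import Data.Empty

complement : ∀ {n} → Graph n → Graph n
complement G = record
  { adj = λ u v → not (adj G u v) ∧ neqF u v
  ; sym = λ u v → Relation.Binary.PropositionalEquality.cong₂ (λ a b → not a ∧ b) (sym G u v) (neqF-sym u v)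
  ; irrefl = λ v → lem (not (adj G v v)) (neqF-irr v)
  }
  where
  lem : ∀ a {b} → b ≡ false → a ∧ b ≡ false
  lem false _ = refl
  lem true e = e

-- disjoint union of k copies of K₄, on vertex set Fin (4 * k):
-- u ~ v iff u ≠ v and ⌊u/4⌋ = ⌊v/4⌋
kK4 : (k : ℕ) → Graph (4 * k)
kK4 k = record
  { adj = λ u v → neqF u v ∧ ⌊ toℕ u / 4 ≟ℕ toℕ v / 4 ⌋
  ; sym = λ u v → Relation.Binary.PropositionalEquality.cong₂ _∧_ (neqF-sym u v) (blk u v)
  ; irrefl = λ v → Relation.Binary.PropositionalEquality.cong (_∧ ⌊ toℕ v / 4 ≟ℕ toℕ v / 4 ⌋) (neqF-irr v)
  }
  where
  blk : (u v : Fin (4 * k)) → ⌊ toℕ u / 4 ≟ℕ toℕ v / 4 ⌋ ≡ ⌊ toℕ v / 4 ≟ℕ toℕ u / 4 ⌋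
  blk u v with toℕ u / 4 ≟ℕ toℕ v / 4 | toℕ v / 4 ≟ℕ toℕ u / 4
  ... | Relation.Nullary.yes _ | Relation.Nullary.yes _ = refl
  ... | Relation.Nullary.no _  | Relation.Nullary.no _  = refl
  ... | Relation.Nullary.yes p | Relation.Nullary.no q = Data.Empty.⊥-elim (q (Relation.Binary.PropositionalEquality.sym p))
    where import Data.Empty
  ... | Relation.Nullary.no q | Relation.Nullary.yes p = Data.Empty.⊥-elim (q (Relation.Binary.PropositionalEquality.sym p))
    where import Data.Empty

fromEdges : (n : ℕ) (e : ℕ → ℕ → Bool) → (∀ a → e a a ≡ false) → Graph n
fromEdges n e noLoop = record
  { adj = λ u v → e (toℕ u) (toℕ v) ∨ e (toℕ v) (toℕ u)
  ; sym = λ u v → ∨-comm (e (toℕ u) (toℕ v)) (e (toℕ v) (toℕ u))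
  ; irrefl = λ v → Relation.Binary.PropositionalEquality.cong₂ _∨_ (noLoop (toℕ v)) (noLoop (toℕ v))
  }

-- S_n[4] (for n ≥ 5): vertex 0 = centre c of S_{n-4}, vertices 5..n-1 its n-5 leaves;
-- vertex 1 = the degree-one vertex of S_4 joined to c, 2 = centre of S_4, 3,4 = other leaves of S_4.
eS : ℕ → ℕ → Bool
eS 0 1 = true
eS 1 2 = true
eS 2 3 = true
eS 2 4 = true
eS 0 (suc (suc (suc (suc (suc _))))) = true
eS _ _ = false

eS-noLoop : ∀ a → eS a a ≡ false
eS-noLoop 0 = refl
eS-noLoop 1 = refl
eS-noLoop 2 = refl
eS-noLoop 3 = refl
eS-noLoop 4 = refl
eS-noLoop (suc (suc (suc (suc (suc _))))) = refl

Sn4 : (n : ℕ) → Graph n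
Sn4 n = fromEdges n eS eS-noLoop

-- T_A(n) (for n ≥ 5): 0 = c, 1 = x, 2 = y, 3 = z, 4 = w, vertices 5..n-1 the n-5 leaves at c.
-- Edges: c-x, x-y, x-z, y-w, c-j (j ≥ 5).
eT : ℕ → ℕ → Bool
eT 0 1 = true
eT 1 2 = true
eT 1 3 = true
eT 2 4 = true
eT 0 (suc (suc (suc (suc (suc _))))) = true
eT _ _ = false

eT-noLoop : ∀ a → eT a a ≡ false
eT-noLoop 0 = refl
eT-noLoop 1 = refl
eT-noLoop 2 = refl
eT-noLoop 3 = refl
eT-noLoop 4 = refl
eT-noLoop (suc (suc (suc (suc (suc _))))) = refl

TA : (n : ℕ) → Graph n
TA n = fromEdges n eT eT-noLoop

-- Non-adjacency in H is a graph of maximum degree at most 3.  If some vertex c has no cherry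
-- among its non-neighbours (x, y, z with x, y and y, z non-adjacent), both trees embed with c
-- as the vertex of degree n − 4: the at most three non-neighbours of c go to the three tree
-- vertices not adjacent to it, and the remaining vertices of the trees are chosen greedily, since
-- every vertex misses at most three others.  Otherwise every vertex lies with its three
-- non-neighbours in a 4-set of pairwise non-adjacent vertices, so non-adjacency is an
-- equivalence relation with classes of size 4, and numbering the classes gives the isomorphism
-- with (n/4)K₄.

module Submission where

open import Defs hiding (sym)

open import Data.Nat.Properties using (+-*-semiring)
open import Algebra.Properties.Semiring.Sum +-*-semiring
  using (sum; sum-syntax; sum-cong-≗; ∑-distrib-+; ∑-comm; sum-replicate-zero; *-distribʳ-sum)
open import Data.Bool using (Bool; true; false; _∧_; _∨_; not; if_then_else_)
open import Data.Bool.Properties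
  using (∧-comm; ∧-conicalˡ; ∧-conicalʳ; ∧-distribʳ-∨; ∧-identityʳ; ∧-zeroʳ; ∨-conicalˡ; ∨-conicalʳ; ¬-not; not-injective)
  renaming (_≟_ to _≟ᵇ_)
open import Data.Empty using (⊥-elim)
open import Data.Fin using (Fin; zero; suc; toℕ; fromℕ<; inject≤; punchOut)
open import Data.Fin.Patterns using (0F; 1F; 2F; 3F; 4F)
open import Data.Fin.Permutation as Perm using (Permutation′; _⟨$⟩ʳ_; _∘ₚ_)
import Data.Fin.Permutation.Components as PC
open import Data.Fin.Properties
  using ( _≟_; any?; all?; suc-injective; 0≢1+n; toℕ-injective; toℕ-inject≤; inject≤-injective; toℕ<n; toℕ-fromℕ<
        ; punchOut-injective; injective⇒≤ )
open import Data.List as List using (List; []; _∷_; length; filter; allFin; _∷ʳ_; _++_)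
open import Data.List.Membership.Propositional using (_∈_; _∉_)
open import Data.List.Membership.Propositional.Properties using (∈-lookup; ∈-filter⁺; ∈-filter⁻; ∈-allFin)
open import Data.List.Properties using (map-tabulate)
open import Data.List.Relation.Binary.Permutation.Propositional using (_↭_; prep; swap; ↭-refl; ↭-trans; ↭⇒↭ₛ)
open import Data.List.Relation.Binary.Permutation.Propositional.Properties using (All-resp-↭; ∈-resp-↭)
open import Data.List.Relation.Binary.Permutation.Setoid.Properties using (Unique-resp-↭)
open import Data.List.Relation.Binary.Subset.Propositional.Properties using (xs⊆xs++ys)
open import Data.List.Relation.Unary.All as All using (All; []; _∷_)
open import Data.List.Relation.Unary.All.Properties using (¬Any⇒All¬; ∷ʳ⁺)
open import Data.List.Relation.Unary.AllPairs using (AllPairs; []; _∷_)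
open import Data.List.Relation.Unary.Any using (here; there; index)
open import Data.List.Relation.Unary.Any.Properties using (lookup-index)
open import Data.List.Relation.Unary.Unique.Propositional using (Unique)
open import Data.List.Relation.Unary.Unique.Propositional.Properties using (filter⁺; allFin⁺)
open import Data.Nat using (ℕ; zero; suc; _+_; _*_; _∸_; _/_; _%_; _≤_; _<_; z≤n; s≤s; _≤?_; _<?_; NonZero)
import Data.Nat.ListAction as ListSum
open import Data.Nat.DivMod using (m*n/n≡m; m*n%n≡0; +-distrib-/-∣ʳ; m<n⇒m/n≡0)
open import Data.Nat.Divisibility using (divides)
open import Data.Nat.Properties
  using ( ≤-refl; ≤-reflexive; ≤-trans; ≤-antisym; ≤-pred; <-irrefl; <-trans; <-≤-trans; <-cmp; <⇒≢; 1+n≰n; m≤m+n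
        ; m≤n+m∸n; m+n≤o⇒m≤o∸n; +-comm; +-identityʳ; *-comm; +-mono-≤; +-monoˡ-≤; +-monoʳ-≤; +-monoˡ-<; *-monoˡ-≤
        ; +-cancelʳ-≤; +-cancelʳ-≡; module ≤-Reasoning )
  renaming (_≟_ to _≟ℕ_)
open import Data.Product using (Σ; ∃; _×_; _,_; proj₁; proj₂)
open import Data.Sum using (_⊎_; inj₁; inj₂)
open import Function using (_∘_; id)
open import Function.Bundles using (_↔_; Inverse; Injection; mk↔ₛ′)
open import Function.Definitions using (Injective)
open import Function.Properties.Inverse using (↔⇒↣)
open import Relation.Binary.Definitions using (tri<; tri≈; tri>)
open import Relation.Binary.PropositionalEquality as ≡
  using (_≡_; _≢_; _≗_; refl; sym; trans; cong; cong₂; subst; subst₂; ≢-sym; module ≡-Reasoning)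
open import Relation.Nullary using (Dec; yes; no; ¬_; ¬?; does; contradiction)
open import Relation.Nullary.Decidable
  using (⌊_⌋; True; toWitness; dec-true; dec-false; decidable-stable; _×-dec_; _→-dec_)

-- Counting on Fin n

indicator : Bool → ℕ
indicator b = if b then 1 else 0

count : ∀ {n} → (Fin n → Bool) → ℕ
count {n} p = ∑[ u < n ] indicator (p u)

module _ {n : ℕ} where

  count-cong : {p q : Fin n → Bool} → p ≗ q → count p ≡ count q
  count-cong p≗q = sum-cong-≗ (cong indicator ∘ p≗q)

  count-false : count {n} (λ _ → false) ≡ 0
  count-false = sum-replicate-zero n

  count-split : (p q : Fin n → Bool) → count p ≡ count (λ u → p u ∧ q u) + count (λ u → p u ∧ not (q u))
  count-split p q = trans (sum-cong-≗ (λ u → split (p u) (q u))) (∑-distrib-+ (λ u → indicator (p u ∧ q u)) _)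
    where
    split : ∀ a b → indicator a ≡ indicator (a ∧ b) + indicator (a ∧ not b)
    split false _ = refl
    split true true = refl
    split true false = refl

  count-∨ : (p q : Fin n → Bool) → count (λ u → p u ∨ q u) ≡ count p + count (λ u → q u ∧ not (p u))
  count-∨ p q = trans (sum-cong-≗ (λ u → split (p u) (q u))) (∑-distrib-+ (indicator ∘ p) _)
    where
    split : ∀ a b → indicator (a ∨ b) ≡ indicator a + indicator (b ∧ not a)
    split true true = refl
    split true false = refl
    split false true = refl
    split false false = refl

count-true : ∀ {n} → count {n} (λ _ → true) ≡ n
count-true {zero} = refl
count-true {suc n} = cong suc (count-true {n})

count-complement : ∀ {n} (p : Fin n → Bool) → count p + count (not ∘ p) ≡ n
count-complement {n} p =
  trans (sym (∑-distrib-+ (indicator ∘ p) _)) (trans (sum-cong-≗ (λ u → one (p u))) (count-true {n}))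
  where
  one : ∀ b → indicator b + indicator (not b) ≡ indicator true
  one true = refl
  one false = refl

count-mono : ∀ {n} {p q : Fin n → Bool} → (∀ u → p u ≡ true → q u ≡ true) → count p ≤ count q
count-mono {zero} _ = z≤n
count-mono {suc n} p⇒q = +-mono-≤ (indicator-mono (p⇒q zero)) (count-mono (p⇒q ∘ suc))
  where
  indicator-mono : ∀ {a b} → (a ≡ true → b ≡ true) → indicator a ≤ indicator b
  indicator-mono {false} _ = z≤n
  indicator-mono {true} a⇒b rewrite a⇒b refl = s≤s z≤n

count-singleton : ∀ {n} (a : Fin n) → count (λ u → does (u ≟ a)) ≡ 1
count-singleton {suc n} zero = cong suc (count-false {n})
count-singleton {suc n} (suc a) = count-singleton a

count-remove : ∀ {n} (p : Fin n → Bool) {a} → p a ≡ true → count p ≡ suc (count (λ u → p u ∧ not (does (u ≟ a))))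
count-remove p {a} pa = begin
  count p                                   ≡⟨ count-split p (λ u → does (u ≟ a)) ⟩
  count (λ u → p u ∧ does (u ≟ a)) + rest   ≡⟨ cong (_+ rest) (trans (count-cong at-a) (count-singleton a)) ⟩
  suc rest                                  ∎
  where
  open ≡-Reasoning
  rest = count (λ u → p u ∧ not (does (u ≟ a)))
  at-a : ∀ u → p u ∧ does (u ≟ a) ≡ does (u ≟ a)
  at-a u with u ≟ a
  ... | yes refl = cong (_∧ true) pa
  ... | no _ = ∧-zeroʳ (p u)

count-< : ∀ {n} {p q : Fin n → Bool} {a} → (∀ u → p u ≡ true → q u ≡ true) → p a ≡ false → q a ≡ true → count p < count q
count-< {p = p} {q} {a} p⇒q pa qa = subst (count p <_) (sym (count-remove q qa)) (s≤s (count-mono p⇒q∖a))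
  where
  p⇒q∖a : ∀ u → p u ≡ true → q u ∧ not (does (u ≟ a)) ≡ true
  p⇒q∖a u pu with u ≟ a
  ... | yes refl = contradiction (trans (sym pu) pa) λ ()
  ... | no _ = trans (∧-identityʳ (q u)) (p⇒q u pu)

length≤count : ∀ {n} {p : Fin n → Bool} {xs} → Unique xs → All (λ x → p x ≡ true) xs → length xs ≤ count p
length≤count [] [] = z≤n
length≤count {p = p} {a ∷ xs} (a∉xs ∷ uxs) (pa ∷ pxs) =
  subst (suc (length xs) ≤_) (sym (count-remove p pa)) (s≤s (length≤count uxs (All.zipWith keep (a∉xs , pxs))))
  where
  keep : ∀ {x} → a ≢ x × p x ≡ true → p x ∧ not (does (x ≟ a)) ≡ true
  keep {x} (a≢x , px) rewrite px | dec-false (x ≟ a) (a≢x ∘ sym) = refl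

count≡1 : ∀ {n} {p : Fin n → Bool} {a} → p a ≡ true → (∀ u → p u ≡ true → u ≡ a) → count p ≡ 1
count≡1 {n} {p} {a} pa only-a = trans (count-remove p pa) (cong suc (trans (count-cong none) (count-false {n})))
  where
  none : ∀ u → p u ∧ not (does (u ≟ a)) ≡ false
  none u with p u in pu
  ... | false = refl
  ... | true rewrite dec-true (u ≟ a) (only-a u pu) = refl

count<⇒false : ∀ {n} (p : Fin n → Bool) → count p < n → ∃ λ u → p u ≡ false
count<⇒false {n} p count<n with any? (λ u → p u ≟ᵇ false)
... | yes found = found
... | no none = ⊥-elim (<-irrefl (trans (count-cong all-true) (count-true {n})) count<n)
  where
  all-true : ∀ u → p u ≡ true
  all-true u = ¬-not (λ pu → none (u , pu))

count-∨≤ : ∀ {n} (p q : Fin n → Bool) → count (λ u → p u ∨ q u) ≤ count p + count q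
count-∨≤ p q = ≤-trans (≤-reflexive (count-∨ p q)) (+-monoʳ-≤ (count p) (count-mono (λ u → ∧-conicalˡ (q u) _)))

sum-tabulate : ∀ {k} (f : Fin k → ℕ) → ListSum.sum (List.tabulate f) ≡ ∑[ i < k ] f i
sum-tabulate {zero} f = refl
sum-tabulate {suc k} f = cong (f zero +_) (sum-tabulate (f ∘ suc))

deg≡count : ∀ {n} (G : Graph n) v → deg G v ≡ count (adj G v)
deg≡count {n} G v =
  trans (cong ListSum.sum (map-tabulate {n = n} id (indicator ∘ adj G v))) (sum-tabulate (indicator ∘ adj G v))

module _ {n : ℕ} where

  open import Data.List.Membership.DecPropositional (_≟_ {n}) using (_∈?_)

  count-∈ : (F : List (Fin n)) → count (λ u → does (u ∈? F)) ≤ length F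
  count-∈ [] = ≤-reflexive (count-false {n})
  count-∈ (f ∷ F) = ≤-trans (count-∨≤ (λ u → does (u ≟ f)) (λ u → does (u ∈? F)))
                            (+-mono-≤ (≤-reflexive (count-singleton f)) (count-∈ F))

  outsideAvoiding : (F : List (Fin n)) (bad : Fin n → Bool) →
                    length F + count (λ u → bad u ∧ not (does (u ∈? F))) < n → ∃ λ u → u ∉ F × bad u ≡ false
  outsideAvoiding F bad fits =
    let u , neither = count<⇒false (λ u → does (u ∈? F) ∨ bad u) bound
    in u , (λ u∈F → contradiction (trans (sym (dec-true (u ∈? F) u∈F)) (∨-conicalˡ _ _ neither)) λ ())
         , ∨-conicalʳ _ _ neither
    where
    open ≤-Reasoning
    bound : count (λ u → does (u ∈? F) ∨ bad u) < n
    bound = begin-strict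
      count (λ u → does (u ∈? F) ∨ bad u)                                       ≡⟨ count-∨ (λ u → does (u ∈? F)) bad ⟩
      count (λ u → does (u ∈? F)) + count (λ u → bad u ∧ not (does (u ∈? F)))  ≤⟨ +-monoˡ-≤ _ (count-∈ F) ⟩
      length F + count (λ u → bad u ∧ not (does (u ∈? F)))                      <⟨ fits ⟩
      n                                                                          ∎

lookup-injective : ∀ {A : Set} {xs : List A} → Unique xs → Injective _≡_ _≡_ (List.lookup xs)
lookup-injective {xs = _ ∷ _} _ {zero} {zero} _ = refl
lookup-injective {xs = _ ∷ _} (x∉xs ∷ _) {zero} {suc j} x≡xj = contradiction x≡xj (All.lookup x∉xs (∈-lookup j))
lookup-injective {xs = _ ∷ _} (x∉xs ∷ _) {suc i} {zero} xi≡x = contradiction (sym xi≡x) (All.lookup x∉xs (∈-lookup i))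
lookup-injective {xs = _ ∷ _} (_ ∷ unique) {suc i} {suc j} xi≡xj = cong suc (lookup-injective unique xi≡xj)

AllPairs-lookup : ∀ {A : Set} {R : A → A → Set} {xs p q} → (∀ {a b} → R a b → R b a) →
                  AllPairs R xs → p ∈ xs → q ∈ xs → p ≢ q → R p q
AllPairs-lookup _ _ (here refl) (here refl) p≢q = contradiction refl p≢q
AllPairs-lookup _ (R-xs ∷ _) (here refl) (there q∈xs) _ = All.lookup R-xs q∈xs
AllPairs-lookup R-sym (R-xs ∷ _) (there p∈xs) (here refl) _ = R-sym (All.lookup R-xs p∈xs)
AllPairs-lookup R-sym (_ ∷ pairs) (there p∈xs) (there q∈xs) p≢q = AllPairs-lookup R-sym pairs p∈xs q∈xs p≢q

Unique-insert : ∀ {A : Set} {c x : A} {xs} → Unique (c ∷ xs) → x ∉ c ∷ xs → Unique (c ∷ x ∷ xs)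
Unique-insert (c≢xs ∷ unique) x∉ with ¬Any⇒All¬ _ x∉
... | x≢c ∷ x≢xs = (≢-sym x≢c ∷ c≢xs) ∷ x≢xs ∷ unique

Unique-∷ʳ : ∀ {A : Set} {x : A} {xs} → Unique xs → x ∉ xs → Unique (xs ∷ʳ x)
Unique-∷ʳ {xs = []} [] _ = [] ∷ []
Unique-∷ʳ {xs = y ∷ ys} (y≢ys ∷ unique) x∉ =
  ∷ʳ⁺ y≢ys (λ y≡x → x∉ (here (sym y≡x))) ∷ Unique-∷ʳ unique (x∉ ∘ there)

does-true : ∀ {P : Set} (P? : Dec P) → does P? ≡ true → P
does-true (yes p) _ = p

does-⇔ : ∀ {P Q : Set} (P? : Dec P) (Q? : Dec Q) → (P → Q) → (Q → P) → does P? ≡ does Q?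
does-⇔ (yes _) (yes _) _ _ = refl
does-⇔ (no _) (no _) _ _ = refl
does-⇔ (yes p) (no ¬q) p⇒q _ = contradiction (p⇒q p) ¬q
does-⇔ (no ¬p) (yes q) _ q⇒p = contradiction (q⇒p q) ¬p

least : ∀ {n} (p : Fin n → Bool) {a} → p a ≡ true →
        ∃ λ m → p m ≡ true × (∀ w → p w ≡ true → toℕ m ≤ toℕ w)
least {suc n} p {a} pa with p zero in p0
... | true = zero , p0 , λ _ _ → z≤n
least {suc n} p {zero} pa | false = contradiction (trans (sym pa) p0) λ ()
least {suc n} p {suc a} pa | false with least (p ∘ suc) pa
... | m , pm , m-least = suc m , pm , λ where
  zero pw → contradiction (trans (sym pw) p0) λ ()
  (suc w) pw → s≤s (m-least w pw)

injective⇒surjective : ∀ {m} (f : Fin m → Fin m) → Injective _≡_ _≡_ f → ∀ y → ∃ λ x → f x ≡ y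
injective⇒surjective {suc m} f f-inj y with any? (λ x → f x ≟ y)
... | yes found = found
... | no missed =
  contradiction (injective⇒≤ {f = punchOut ∘ avoids} (λ eq → f-inj (punchOut-injective (avoids _) (avoids _) eq))) 1+n≰n
  where
  avoids : ∀ x → y ≢ f x
  avoids x y≡fx = missed (x , sym y≡fx)

injective⇒↔ : ∀ {m m′} → m ≡ m′ → (f : Fin m → Fin m′) → Injective _≡_ _≡_ f →
              Σ (Fin m ↔ Fin m′) λ ψ → ∀ x → Inverse.to ψ x ≡ f x
injective⇒↔ refl f f-inj = mk↔ₛ′ f (proj₁ ∘ surj) (proj₂ ∘ surj) (λ x → f-inj (proj₂ (surj (f x)))) , λ _ → refl
  where surj = injective⇒surjective f f-inj

transpose-source : ∀ {n} (i j : Fin n) → PC.transpose i j i ≡ j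
transpose-source i j rewrite dec-true (i ≟ i) refl = refl

transpose-fixes : ∀ {n} {i j k : Fin n} → k ≢ i → k ≢ j → PC.transpose i j k ≡ k
transpose-fixes {i = i} {j} {k} k≢i k≢j rewrite dec-false (k ≟ i) k≢i | dec-false (k ≟ j) k≢j = refl

extendInjection : ∀ {k n} (ps qs : Fin k → Fin n) → Injective _≡_ _≡_ ps → Injective _≡_ _≡_ qs →
                  Σ (Permutation′ n) λ π → ∀ i → π ⟨$⟩ʳ ps i ≡ qs i
extendInjection {zero} _ _ _ _ = Perm.id , λ ()
extendInjection {suc k} ps qs ps-inj qs-inj = π ∘ₚ Perm.transpose (π ⟨$⟩ʳ ps zero) (qs zero) , sends
  where
  rest = extendInjection (ps ∘ suc) (qs ∘ suc) (λ e → suc-injective (ps-inj e)) (λ e → suc-injective (qs-inj e))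
  π = proj₁ rest
  sends : ∀ i → PC.transpose (π ⟨$⟩ʳ ps zero) (qs zero) (π ⟨$⟩ʳ ps i) ≡ qs i
  sends zero = transpose-source (π ⟨$⟩ʳ ps zero) (qs zero)
  sends (suc i) rewrite proj₂ rest i =
    transpose-fixes (λ q≡π → 0≢1+n (sym (ps-inj (Injection.injective (↔⇒↣ π) (trans (proj₂ rest i) q≡π)))))
                    (λ e → 0≢1+n (qs-inj (sym e)))

neqF-injective : ∀ {m n} {f : Fin m → Fin n} → Injective _≡_ _≡_ f → ∀ u v → neqF (f u) (f v) ≡ neqF u v
neqF-injective {f = f} f-inj u v with u ≟ v
... | yes refl = trans (neqF-irr (f u)) (sym (neqF-irr u))
... | no u≢v = trans (neqF-≢ (u≢v ∘ f-inj)) (sym (neqF-≢ u≢v))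
  where
  neqF-≢ : ∀ {k} {a b : Fin k} → a ≢ b → neqF a b ≡ true
  neqF-≢ {a = a} {b} a≢b with toℕ a ≟ℕ toℕ b
  ... | yes toℕa≡toℕb = contradiction (toℕ-injective toℕa≡toℕb) a≢b
  ... | no _ = refl

module NonAdjacency {n : ℕ} (H : Graph n) where

  infix 4 _~_ _≁_ _≁?_

  _~_ : Fin n → Fin n → Set
  u ~ v = adj H u v ≡ true

  ~-sym : ∀ {u v} → u ~ v → v ~ u
  ~-sym {u} {v} u~v = trans (Graph.sym H v u) u~v

  _≁_ : Fin n → Fin n → Set
  u ≁ v = adj H u v ≡ false × u ≢ v

  ≁-sym : ∀ {u v} → u ≁ v → v ≁ u
  ≁-sym {u} {v} (nonadj , u≢v) = trans (Graph.sym H v u) nonadj , ≢-sym u≢v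

  _≁?_ : ∀ u v → Dec (u ≁ v)
  u ≁? v = (adj H u v ≟ᵇ false) ×-dec ¬? (u ≟ v)

  record NonNeighbourhood (c : Fin n) (xs : List (Fin n)) : Set where
    field
      unique      : Unique xs
      nonadjacent : All (c ≁_) xs
      complete    : ∀ {u} → c ≁ u → u ∈ xs

  nonNeighbourhood : ∀ c → ∃ (NonNeighbourhood c)
  nonNeighbourhood c = filter (c ≁?_) (allFin n) , record
    { unique      = filter⁺ (c ≁?_) (allFin⁺ n)
    ; nonadjacent = All.tabulate (proj₂ ∘ ∈-filter⁻ (c ≁?_) {xs = allFin n})
    ; complete    = ∈-filter⁺ (c ≁?_) (∈-allFin _)
    }

  NonNeighbourhood-resp-↭ : ∀ {c xs ys} → xs ↭ ys → NonNeighbourhood c xs → NonNeighbourhood c ys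
  NonNeighbourhood-resp-↭ xs↭ys N = record
    { unique      = Unique-resp-↭ (≡.setoid (Fin n)) (↭⇒↭ₛ xs↭ys) unique
    ; nonadjacent = All-resp-↭ xs↭ys nonadjacent
    ; complete    = ∈-resp-↭ xs↭ys ∘ complete
    }
    where open NonNeighbourhood N

  Cherry : Fin n → Set
  Cherry c = ∃ λ x → ∃ λ y → ∃ λ z → c ≁ x × c ≁ y × c ≁ z × x ≁ y × y ≁ z × x ≢ z

  cherry? : ∀ c → Dec (Cherry c)
  cherry? c = any? λ x → any? λ y → any? λ z →
    c ≁? x ×-dec c ≁? y ×-dec c ≁? z ×-dec x ≁? y ×-dec y ≁? z ×-dec ¬? (x ≟ z)

-- Embedding trees with a hub

module _ {n : ℕ} (H : Graph n) where

  open NonAdjacency H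

  -- Vertices 0, …, length vs ∸ 1 of a pattern form its head, to be placed on vs; the hub 0 is
  -- adjacent to every vertex beyond the head.
  data HubOrHead (vs : List (Fin n)) : ℕ → ℕ → Set where
    hub  : ∀ {b} → length vs ≤ b → HubOrHead vs 0 b
    head : ∀ i j → List.lookup vs i ~ List.lookup vs j → HubOrHead vs (toℕ i) (toℕ j)

  -- The head is placed by a permutation of Fin n; the leaves then land outside c ∷ qs, hence on
  -- neighbours of c.
  hubEmbedding : ∀ (e : ℕ → ℕ → Bool) (noLoop : ∀ a → e a a ≡ false) (c : Fin n) (qs : List (Fin n)) →
                 length (c ∷ qs) ≤ n → Unique (c ∷ qs) → (∀ a b → e a b ≡ true → HubOrHead (c ∷ qs) a b) →
                 (∀ u → adj H c u ≡ false → u ∈ c ∷ qs) → fromEdges n e noLoop ⊆G H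
  hubEmbedding e noLoop c qs fits unique classify cover = (π ⟨$⟩ʳ_) , (λ _ _ → π-injective) , edge
    where
    position : Fin (length (c ∷ qs)) → Fin n
    position i = inject≤ i fits

    extension = extendInjection position (List.lookup (c ∷ qs)) (inject≤-injective fits fits _ _) (lookup-injective unique)
    π = proj₁ extension
    π-injective = Injection.injective (↔⇒↣ π)

    at : ∀ {u} i → toℕ u ≡ toℕ i → π ⟨$⟩ʳ u ≡ List.lookup (c ∷ qs) i
    at i u≡i = trans (cong (π ⟨$⟩ʳ_) (toℕ-injective (trans u≡i (sym (toℕ-inject≤ i fits))))) (proj₂ extension i)

    leaf : ∀ {v} → length (c ∷ qs) ≤ toℕ v → c ~ π ⟨$⟩ʳ v
    leaf {v} beyond = ¬-not λ nonadj →
      let i = index (cover _ nonadj)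
          v≡i = trans (cong toℕ (π-injective (trans (lookup-index (cover _ nonadj)) (sym (proj₂ extension i)))))
                      (toℕ-inject≤ i fits)
      in <-irrefl (sym v≡i) (<-≤-trans (toℕ<n i) beyond)

    directed : ∀ {a b u v} → HubOrHead (c ∷ qs) a b → toℕ u ≡ a → toℕ v ≡ b → π ⟨$⟩ʳ u ~ π ⟨$⟩ʳ v
    directed {v = v} (hub beyond) u≡0 refl = subst (_~ π ⟨$⟩ʳ v) (sym (at zero u≡0)) (leaf beyond)
    directed (head i j qi~qj) u≡i v≡j = subst₂ _~_ (sym (at i u≡i)) (sym (at j v≡j)) qi~qj

    edge : ∀ u v → adj (fromEdges n e noLoop) u v ≡ true → π ⟨$⟩ʳ u ~ π ⟨$⟩ʳ v
    edge u v uv with e (toℕ u) (toℕ v) in forward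
    ... | true = directed (classify _ _ forward) refl refl
    ... | false = ~-sym (directed (classify _ _ uv) refl refl)

module HubTrees {n : ℕ} (H : Graph n) (5≤n : 5 ≤ n) where

  open NonAdjacency H

  private
    leaf : ∀ {v₀ v₁ v₂ v₃ v₄} b → HubOrHead H (v₀ ∷ v₁ ∷ v₂ ∷ v₃ ∷ v₄ ∷ []) 0 (5 + b)
    leaf b = hub (m≤m+n 5 b)

    coveredBy234 : ∀ {c a x y z} → (∀ {u} → c ≁ u → u ∈ x ∷ y ∷ z ∷ []) →
                   ∀ u → adj H c u ≡ false → u ∈ c ∷ a ∷ x ∷ y ∷ z ∷ []
    coveredBy234 {c} cover u nonadj with c ≟ u
    ... | yes refl = here refl
    ... | no c≢u = there (there (cover (nonadj , c≢u)))

  Sn4-embedding : ∀ {c a b d e} → Unique (c ∷ a ∷ b ∷ d ∷ e ∷ []) →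
                  c ~ a → a ~ b → b ~ d → b ~ e →
                  (∀ {u} → c ≁ u → u ∈ b ∷ d ∷ e ∷ []) → Sn4 n ⊆G H
  Sn4-embedding {c} {a} {b} {d} {e} unique c~a a~b b~d b~e cover =
    hubEmbedding H eS eS-noLoop c _ 5≤n unique edge (coveredBy234 cover)
    where
    edge : ∀ x y → eS x y ≡ true → HubOrHead H (c ∷ a ∷ b ∷ d ∷ e ∷ []) x y
    edge 0 0 ()
    edge 0 1 _ = head 0F 1F c~a
    edge 0 2 ()
    edge 0 3 ()
    edge 0 4 ()
    edge 0 (suc (suc (suc (suc (suc y))))) _ = leaf y
    edge 1 0 ()
    edge 1 1 ()
    edge 1 2 _ = head 1F 2F a~b
    edge 1 (suc (suc (suc y))) ()
    edge 2 0 ()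
    edge 2 1 ()
    edge 2 2 ()
    edge 2 3 _ = head 2F 3F b~d
    edge 2 4 _ = head 2F 4F b~e
    edge 2 (suc (suc (suc (suc (suc y))))) ()
    edge (suc (suc (suc x))) y ()

  TA-embedding : ∀ {c x y z w} → Unique (c ∷ x ∷ y ∷ z ∷ w ∷ []) →
                 c ~ x → x ~ y → x ~ z → y ~ w →
                 (∀ {u} → c ≁ u → u ∈ y ∷ z ∷ w ∷ []) → TA n ⊆G H
  TA-embedding {c} {x} {y} {z} {w} unique c~x x~y x~z y~w cover =
    hubEmbedding H eT eT-noLoop c _ 5≤n unique edge (coveredBy234 cover)
    where
    edge : ∀ a b → eT a b ≡ true → HubOrHead H (c ∷ x ∷ y ∷ z ∷ w ∷ []) a b
    edge 0 0 ()
    edge 0 1 _ = head 0F 1F c~x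
    edge 0 2 ()
    edge 0 3 ()
    edge 0 4 ()
    edge 0 (suc (suc (suc (suc (suc b))))) _ = leaf b
    edge 1 0 ()
    edge 1 1 ()
    edge 1 2 _ = head 1F 2F x~y
    edge 1 3 _ = head 1F 3F x~z
    edge 1 (suc (suc (suc (suc b)))) ()
    edge 2 0 ()
    edge 2 1 ()
    edge 2 2 ()
    edge 2 3 ()
    edge 2 4 _ = head 2F 4F y~w
    edge 2 (suc (suc (suc (suc (suc b))))) ()
    edge (suc (suc (suc a))) b ()

-- Equivalence relations whose classes have equal size

[s+r*m]/m≡r : ∀ r s {m} .{{_ : NonZero m}} → s < m → (s + r * m) / m ≡ r
[s+r*m]/m≡r r s {m} s<m = trans (+-distrib-/-∣ʳ s (divides r refl)) (cong₂ _+_ (m<n⇒m/n≡0 s<m) (m*n/n≡m r m))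

module Blocks {n m : ℕ} .{{_ : NonZero m}} (R : Fin n → Fin n → Bool)
  (R-refl : ∀ v → R v v ≡ true) (R-sym : ∀ {u v} → R u v ≡ true → R v u ≡ true)
  (R-trans : ∀ {u v w} → R u v ≡ true → R v w ≡ true → R u w ≡ true) (R-size : ∀ v → count (R v) ≡ m) where

  isLeast? : ∀ u → Dec (∀ w → R u w ≡ true → toℕ u ≤ toℕ w)
  isLeast? u = all? {P = λ w → R u w ≡ true → toℕ u ≤ toℕ w} λ w → (R u w ≟ᵇ true) →-dec (toℕ u ≤? toℕ w)

  precedes? : ∀ (u v : Fin n) → Dec (∀ w → R v w ≡ true → toℕ u < toℕ w)
  precedes? u v = all? {P = λ w → R v w ≡ true → toℕ u < toℕ w} λ w → (R v w ≟ᵇ true) →-dec (toℕ u <? toℕ w)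

  isLeast : Fin n → Bool
  isLeast u = does (isLeast? u)

  precedes : Fin n → Fin n → Bool
  precedes u v = does (precedes? u v)

  classIndex : Fin n → ℕ
  classIndex v = count (λ u → isLeast u ∧ precedes u v)

  offset : Fin n → ℕ
  offset v = count (λ u → R v u ∧ does (toℕ u <? toℕ v))

  classes : ℕ
  classes = count isLeast

  leastOf : ∀ v → ∃ λ ℓ → R v ℓ ≡ true × isLeast ℓ ≡ true
  leastOf v with least (R v) (R-refl v)
  ... | ℓ , v~ℓ , ℓ-least = ℓ , v~ℓ , dec-true (isLeast? ℓ) (λ w ℓ~w → ℓ-least w (R-trans v~ℓ ℓ~w))

  R-class : ∀ {u v} → R u v ≡ true → ∀ w → R u w ≡ R v w
  R-class {u} {v} u~v w with R u w in uw | R v w in vw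
  ... | true  | true  = refl
  ... | false | false = refl
  ... | true  | false = contradiction (trans (sym (R-trans (R-sym u~v) uw)) vw) λ ()
  ... | false | true  = contradiction (trans (sym (R-trans u~v vw)) uw) λ ()

  classIndex-cong : ∀ {u v} → R u v ≡ true → classIndex u ≡ classIndex v
  classIndex-cong {u} {v} u~v =
    count-cong {p = λ x → isLeast x ∧ precedes x u} {q = λ x → isLeast x ∧ precedes x v} λ x →
      cong (isLeast x ∧_) (does-⇔ (precedes? x u) (precedes? x v)
        (λ x<u w v~w → x<u w (trans (R-class u~v w) v~w)) (λ x<v w u~w → x<v w (trans (sym (R-class u~v w)) u~w)))

  classIndex-< : ∀ {u v ℓu ℓv} → R u ℓu ≡ true → isLeast ℓu ≡ true → R v ℓv ≡ true → isLeast ℓv ≡ true →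
                 toℕ ℓu < toℕ ℓv → classIndex u < classIndex v
  classIndex-< {u} {v} {ℓu} {ℓv} u~ℓu ℓu-least v~ℓv ℓv-least ℓu<ℓv =
    count-< {p = λ x → isLeast x ∧ precedes x u} {q = λ x → isLeast x ∧ precedes x v} {a = ℓu} earlier
            (trans (cong (isLeast ℓu ∧_) (dec-false (precedes? ℓu u) λ ℓu<u → <-irrefl refl (ℓu<u ℓu u~ℓu))) (∧-zeroʳ _))
            (trans (cong (_∧ precedes ℓu v) ℓu-least) (dec-true (precedes? ℓu v) λ w v~w → <-≤-trans ℓu<ℓv (below-ℓv v~w)))
    where
    below-ℓv : ∀ {w} → R v w ≡ true → toℕ ℓv ≤ toℕ w
    below-ℓv v~w = does-true (isLeast? ℓv) ℓv-least _ (R-trans (R-sym v~ℓv) v~w)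
    earlier : ∀ x → isLeast x ∧ precedes x u ≡ true → isLeast x ∧ precedes x v ≡ true
    earlier x h = trans (cong (_∧ precedes x v) (∧-conicalˡ _ _ h)) (dec-true (precedes? x v) λ w v~w →
      <-trans (does-true (precedes? x u) (∧-conicalʳ _ _ h) ℓu u~ℓu) (<-≤-trans ℓu<ℓv (below-ℓv v~w)))

  classIndex-≢ : ∀ {u v} → R u v ≡ false → classIndex u ≢ classIndex v
  classIndex-≢ {u} {v} u≁v same with leastOf u | leastOf v
  ... | ℓu , u~ℓu , ℓu-least | ℓv , v~ℓv , ℓv-least with <-cmp (toℕ ℓu) (toℕ ℓv)
  ... | tri< ℓu<ℓv _ _ = <-irrefl same (classIndex-< u~ℓu ℓu-least v~ℓv ℓv-least ℓu<ℓv)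
  ... | tri> _ _ ℓv<ℓu = <-irrefl (sym same) (classIndex-< v~ℓv ℓv-least u~ℓu ℓu-least ℓv<ℓu)
  ... | tri≈ _ ℓu≡ℓv _ = contradiction (trans (sym u~v) u≁v) λ ()
    where u~v = R-trans u~ℓu (R-sym (subst (λ ℓ → R v ℓ ≡ true) (sym (toℕ-injective ℓu≡ℓv)) v~ℓv))

  sameIndex⇒R : ∀ {u v} → classIndex u ≡ classIndex v → R u v ≡ true
  sameIndex⇒R {u} {v} same with R u v in u~v
  ... | true = refl
  ... | false = contradiction same (classIndex-≢ u~v)

  classIndex<classes : ∀ v → classIndex v < classes
  classIndex<classes v with leastOf v
  ... | ℓ , v~ℓ , ℓ-least =
    count-< {p = λ x → isLeast x ∧ precedes x v} {q = isLeast} {a = ℓ} (λ x → ∧-conicalˡ _ _)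
            (trans (cong (isLeast ℓ ∧_) (dec-false (precedes? ℓ v) λ ℓ<v → <-irrefl refl (ℓ<v ℓ v~ℓ))) (∧-zeroʳ _)) ℓ-least

  offset<m : ∀ v → offset v < m
  offset<m v = subst (offset v <_) (R-size v)
    (count-< {p = λ x → R v x ∧ does (toℕ x <? toℕ v)} {q = R v} {a = v} (λ x → ∧-conicalˡ _ _)
             (trans (cong (_∧ does (toℕ v <? toℕ v)) (R-refl v)) (dec-false (toℕ v <? toℕ v) (<-irrefl refl))) (R-refl v))

  offset-< : ∀ {u v} → R u v ≡ true → toℕ u < toℕ v → offset u < offset v
  offset-< {u} {v} u~v u<v =
    count-< {p = λ x → R u x ∧ does (toℕ x <? toℕ u)} {q = λ x → R v x ∧ does (toℕ x <? toℕ v)} {a = u} earlier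
            (trans (cong (_∧ does (toℕ u <? toℕ u)) (R-refl u)) (dec-false (toℕ u <? toℕ u) (<-irrefl refl)))
            (trans (cong (_∧ does (toℕ u <? toℕ v)) (R-sym u~v)) (dec-true (toℕ u <? toℕ v) u<v))
    where
    earlier : ∀ x → R u x ∧ does (toℕ x <? toℕ u) ≡ true → R v x ∧ does (toℕ x <? toℕ v) ≡ true
    earlier x h = trans (cong (_∧ does (toℕ x <? toℕ v)) (R-trans (R-sym u~v) (∧-conicalˡ _ _ h)))
                        (dec-true (toℕ x <? toℕ v) (<-trans (does-true (toℕ x <? toℕ u) (∧-conicalʳ _ _ h)) u<v))

  offset-injective : ∀ {u v} → R u v ≡ true → offset u ≡ offset v → u ≡ v
  offset-injective {u} {v} u~v same with <-cmp (toℕ u) (toℕ v)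
  ... | tri< u<v _ _ = contradiction same (<⇒≢ (offset-< u~v u<v))
  ... | tri≈ _ u≡v _ = toℕ-injective u≡v
  ... | tri> _ _ v<u = contradiction (sym same) (<⇒≢ (offset-< (R-sym u~v) v<u))

  oneLeastPerClass : ∀ v → count (λ u → isLeast u ∧ R u v) ≡ 1
  oneLeastPerClass v with leastOf v
  ... | ℓ , v~ℓ , ℓ-least = count≡1 (trans (cong (_∧ R ℓ v) ℓ-least) (R-sym v~ℓ)) only
    where
    only : ∀ x → isLeast x ∧ R x v ≡ true → x ≡ ℓ
    only x h = toℕ-injective (≤-antisym (does-true (isLeast? x) (∧-conicalˡ _ _ h) ℓ x~ℓ)
                                          (does-true (isLeast? ℓ) ℓ-least x (R-sym x~ℓ)))
      where x~ℓ = R-trans (∧-conicalʳ _ _ h) v~ℓ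

  leastClassSize : ∀ u → count (λ v → isLeast u ∧ R u v) ≡ indicator (isLeast u) * m
  leastClassSize u with isLeast u
  ... | true = trans (R-size u) (sym (+-identityʳ m))
  ... | false = count-false {n}

  n≡classes*m : n ≡ classes * m
  n≡classes*m = begin
    n                                                ≡⟨ count-true ⟨
    ∑[ v < n ] 1                                     ≡⟨ sum-cong-≗ oneLeastPerClass ⟨
    ∑[ v < n ] count (λ u → isLeast u ∧ R u v)       ≡⟨ ∑-comm (λ v u → indicator (isLeast u ∧ R u v)) ⟩
    ∑[ u < n ] count (λ v → isLeast u ∧ R u v)       ≡⟨ sum-cong-≗ leastClassSize ⟩
    ∑[ u < n ] (indicator (isLeast u) * m)           ≡⟨ *-distribʳ-sum m (indicator ∘ isLeast) ⟨
    classes * m                                      ∎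
    where open ≡-Reasoning

  n%m≡0 : n % m ≡ 0
  n%m≡0 = trans (cong (_% m) n≡classes*m) (m*n%n≡0 classes m)

  n≡m*[n/m] : n ≡ m * (n / m)
  n≡m*[n/m] = trans n≡classes*m (trans (*-comm classes m) (cong (m *_) (sym n/m≡classes)))
    where n/m≡classes = trans (cong (_/ m) n≡classes*m) (m*n/n≡m classes m)

  -- Classes are numbered in the order of their least elements.
  position : Fin n → ℕ
  position v = offset v + classIndex v * m

  position< : ∀ v → position v < m * (n / m)
  position< v = subst (position v <_) (trans (sym n≡classes*m) n≡m*[n/m])
    (<-≤-trans (+-monoˡ-< _ (offset<m v)) (*-monoˡ-≤ m (classIndex<classes v)))

  encode : Fin n → Fin (m * (n / m))
  encode v = fromℕ< (position< v)

  encode-block : ∀ v → toℕ (encode v) / m ≡ classIndex v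
  encode-block v =
    trans (cong (_/ m) (toℕ-fromℕ< (position< v))) ([s+r*m]/m≡r (classIndex v) (offset v) (offset<m v))

  encode-injective : Injective _≡_ _≡_ encode
  encode-injective {u} {v} eu≡ev = offset-injective (sameIndex⇒R sameIndex) sameOffset
    where
    sameIndex : classIndex u ≡ classIndex v
    sameIndex = trans (sym (encode-block u)) (trans (cong (λ x → toℕ x / m) eu≡ev) (encode-block v))
    sameOffset : offset u ≡ offset v
    sameOffset = +-cancelʳ-≡ (classIndex u * m) (offset u) (offset v)
      (trans (trans (sym (toℕ-fromℕ< (position< u))) (trans (cong toℕ eu≡ev) (toℕ-fromℕ< (position< v))))
             (cong (λ i → offset v + i * m) (sym sameIndex)))

  sameClassIndex : ∀ u v → ⌊ classIndex u ≟ℕ classIndex v ⌋ ≡ R u v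
  sameClassIndex u v with classIndex u ≟ℕ classIndex v | R u v in u~v
  ... | yes _      | true  = refl
  ... | no _       | false = refl
  ... | yes same   | false = contradiction same (classIndex-≢ u~v)
  ... | no differ  | true  = contradiction (classIndex-cong u~v) differ

  blockIsomorphism : Σ (Fin n ↔ Fin (m * (n / m))) λ ψ →
                     ∀ u v → ⌊ toℕ (Inverse.to ψ u) / m ≟ℕ toℕ (Inverse.to ψ v) / m ⌋ ≡ R u v
  blockIsomorphism =
    let ψ , ψ≗e = injective⇒↔ n≡m*[n/m] encode encode-injective
    in ψ , λ u v → trans (cong₂ (λ a b → ⌊ toℕ a / m ≟ℕ toℕ b / m ⌋) (ψ≗e u) (ψ≗e v))
                         (trans (cong₂ (λ a b → ⌊ a ≟ℕ b ⌋) (encode-block u) (encode-block v)) (sameClassIndex u v))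

-- Graphs of minimum degree at least n ∸ 4

module Search {n : ℕ} (H : Graph n) (8≤n : 8 ≤ n) (δ : minDeg≥ H (n ∸ 4)) where

  open NonAdjacency H
  open import Data.List.Membership.DecPropositional (_≟_ {n}) using (_∈?_)

  -- v itself is counted, as adj H v v ≡ false.
  nonNeighbours≤4 : ∀ v → count (not ∘ adj H v) ≤ 4
  nonNeighbours≤4 v = +-cancelʳ-≤ (n ∸ 4) _ 4 (begin
    count (not ∘ adj H v) + (n ∸ 4)          ≤⟨ +-monoʳ-≤ _ (subst (n ∸ 4 ≤_) (deg≡count H v) (δ v)) ⟩
    count (not ∘ adj H v) + count (adj H v)  ≡⟨ +-comm _ (count (adj H v)) ⟩
    count (adj H v) + count (not ∘ adj H v)  ≡⟨ count-complement (adj H v) ⟩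
    n                                         ≤⟨ m≤n+m∸n n 4 ⟩
    4 + (n ∸ 4)                               ∎)
    where open ≤-Reasoning

  nonNeighboursOutside : List (Fin n) → Fin n → ℕ
  nonNeighboursOutside F r = count (λ u → not (adj H r u) ∧ not (does (u ∈? F)))

  nonNeighboursOutside≤ : ∀ {F r} K → All (_∈ F) (r ∷ K) → Unique K → All (r ≁_) K →
                          nonNeighboursOutside F r ≤ 3 ∸ length K
  nonNeighboursOutside≤ {F} {r} K K⊆F unique r≁K = m+n≤o⇒m≤o∸n (nonNeighboursOutside F r) (begin
    nonNeighboursOutside F r + length (r ∷ K)                 ≤⟨ +-monoʳ-≤ (nonNeighboursOutside F r) inside ⟩
    nonNeighboursOutside F r + count nonadjacentInside        ≡⟨ +-comm (nonNeighboursOutside F r) _ ⟩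
    count nonadjacentInside + nonNeighboursOutside F r        ≡⟨ count-split (not ∘ adj H r) (λ u → does (u ∈? F)) ⟨
    count (not ∘ adj H r)                                     ≤⟨ nonNeighbours≤4 r ⟩
    4                                                         ∎)
    where
    open ≤-Reasoning
    nonadjacentInside : Fin n → Bool
    nonadjacentInside u = not (adj H r u) ∧ does (u ∈? F)
    both : ∀ {k} → k ∈ F × adj H r k ≡ false → nonadjacentInside k ≡ true
    both (k∈F , nonadj) rewrite nonadj | dec-true (_ ∈? F) k∈F = refl
    inside : length (r ∷ K) ≤ count nonadjacentInside
    inside = length≤count (All.map proj₂ r≁K ∷ unique) (All.zipWith both (K⊆F , irrefl H r ∷ All.map proj₁ r≁K))

  neighbourOutside : ∀ F {r} → r ∈ F → {_ : True (length F ≤? 4)} → ∃ λ u → u ∉ F × r ~ u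
  neighbourOutside F {r} r∈F {F≤4} =
    let u , u∉F , nonadj = outsideAvoiding F (not ∘ adj H r)
                             (≤-trans (s≤s (+-mono-≤ (toWitness F≤4) (nonNeighboursOutside≤ [] (r∈F ∷ []) [] []))) 8≤n)
    in u , u∉F , not-injective nonadj

  commonNeighbourOutside : ∀ F {r s} K L → All (_∈ F) (r ∷ K) → Unique K → All (r ≁_) K →
                           All (_∈ F) (s ∷ L) → Unique L → All (s ≁_) L →
                           {_ : True (length F + ((3 ∸ length K) + (3 ∸ length L)) ≤? 7)} →
                           ∃ λ u → u ∉ F × r ~ u × s ~ u
  commonNeighbourOutside F {r} {s} K L K⊆F uK r≁K L⊆F uL s≁L {fits} =
    let u , u∉F , nonadj = outsideAvoiding F (λ u → not (adj H r u) ∨ not (adj H s u))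
                             (≤-trans (s≤s (+-mono-≤ ≤-refl missed)) (≤-trans (s≤s (toWitness fits)) 8≤n))
    in u , u∉F , not-injective (∨-conicalˡ _ _ nonadj) , not-injective (∨-conicalʳ _ _ nonadj)
    where
    outside : Fin n → Bool
    outside u = not (does (u ∈? F))
    missed : count (λ u → (not (adj H r u) ∨ not (adj H s u)) ∧ outside u) ≤ (3 ∸ length K) + (3 ∸ length L)
    missed = ≤-trans (≤-reflexive (count-cong λ u → ∧-distribʳ-∨ (outside u) (not (adj H r u)) (not (adj H s u))))
               (≤-trans (count-∨≤ (λ u → not (adj H r u) ∧ outside u) (λ u → not (adj H s u) ∧ outside u))
                        (+-mono-≤ (nonNeighboursOutside≤ K K⊆F uK r≁K) (nonNeighboursOutside≤ L L⊆F uL s≁L)))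

  ≁-neighbours≤3 : ∀ {v xs} → Unique xs → All (v ≁_) xs → length xs ≤ 3
  ≁-neighbours≤3 {v} unique v≁xs =
    ≤-pred (≤-trans (length≤count (All.map proj₂ v≁xs ∷ unique) (cong not (irrefl H v) ∷ All.map (cong not ∘ proj₁) v≁xs))
                    (nonNeighbours≤4 v))

  open HubTrees H (≤-trans (m≤m+n 5 3) 8≤n)

  module Centred (c : Fin n) where

    Covers : List (Fin n) → Set
    Covers ys = ∀ {u} → c ≁ u → u ∈ ys

    widen : ∀ {ys} zs → Covers ys → Covers (ys ++ zs)
    widen zs cover c≁u = xs⊆xs++ys _ zs (cover c≁u)

    adjacentToCentre : ∀ {ys u} → Covers ys → u ∉ c ∷ ys → c ~ u
    adjacentToCentre cover u∉ = ¬-not λ nonadj → u∉ (there (cover (nonadj , λ c≡u → u∉ (here (sym c≡u)))))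

    adjacent∉ : ∀ {ys x} → All (c ≁_) ys → c ~ x → x ∉ c ∷ ys
    adjacent∉ _ c~x (here refl) = contradiction (trans (sym c~x) (irrefl H c)) λ ()
    adjacent∉ c≁ys c~x (there x∈ys) = contradiction (trans (sym c~x) (proj₁ (All.lookup c≁ys x∈ys))) λ ()

    tooManyNonNeighbours : ∀ {x₁ x₂ x₃ x₄ xs} {A : Set} → NonNeighbourhood c (x₁ ∷ x₂ ∷ x₃ ∷ x₄ ∷ xs) → A
    tooManyNonNeighbours N = contradiction (≁-neighbours≤3 (NonNeighbourhood.unique N) (NonNeighbourhood.nonadjacent N))
                                           λ { (s≤s (s≤s (s≤s ()))) }

    withCentre : ∀ {xs} → NonNeighbourhood c xs → Unique (c ∷ xs)
    withCentre N = All.map proj₂ (NonNeighbourhood.nonadjacent N) ∷ NonNeighbourhood.unique N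

    centreOfTriple : ∀ {x y z} → NonNeighbourhood c (x ∷ y ∷ z ∷ []) → ¬ Cherry c →
                     ∃ λ a → ∃ λ b → ∃ λ d → NonNeighbourhood c (a ∷ b ∷ d ∷ []) × a ~ b × a ~ d
    centreOfTriple {x} {y} {z}
      N@record { unique = (x≢y ∷ x≢z ∷ []) ∷ (y≢z ∷ []) ∷ [] ∷ [] ; nonadjacent = c≁x ∷ c≁y ∷ c≁z ∷ [] } noCherry
      with adj H x y in xy | adj H x z in xz | adj H y z in yz
    ... | true  | true  | _     = x , y , z , N , xy , xz
    ... | true  | false | true  = y , x , z , NonNeighbourhood-resp-↭ (swap x y ↭-refl) N , ~-sym xy , yz
    ... | false | true  | true  =
      z , x , y , NonNeighbourhood-resp-↭ (↭-trans (prep x (swap y z ↭-refl)) (swap x z ↭-refl)) N , ~-sym xz , ~-sym yz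
    ... | true  | false | false = contradiction (x , z , y , c≁x , c≁z , c≁y , (xz , x≢z) , ≁-sym (yz , y≢z) , x≢y) noCherry
    ... | false | true  | false = contradiction (x , y , z , c≁x , c≁y , c≁z , (xy , x≢y) , (yz , y≢z) , x≢z) noCherry
    ... | false | false | true  = contradiction (y , x , z , c≁y , c≁x , c≁z , ≁-sym (xy , x≢y) , (xz , x≢z) , y≢z) noCherry
    ... | false | false | false = contradiction (x , y , z , c≁x , c≁y , c≁z , (xy , x≢y) , (yz , y≢z) , x≢z) noCherry

    Sn4-fromStar : ∀ {b d e} → Unique (c ∷ b ∷ d ∷ e ∷ []) → b ~ d → b ~ e → Covers (b ∷ d ∷ e ∷ []) → Sn4 n ⊆G H
    Sn4-fromStar {b} {d} {e} unique b~d b~e cover =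
      let a , a∉ , b~a = neighbourOutside (c ∷ b ∷ d ∷ e ∷ []) (there (here refl))
      in Sn4-embedding (Unique-insert unique a∉) (adjacentToCentre cover a∉) (~-sym b~a) b~d b~e cover

    Sn4-fromEdge : ∀ {b d} → Unique (c ∷ b ∷ d ∷ []) → b ~ d → Covers (b ∷ d ∷ []) → Sn4 n ⊆G H
    Sn4-fromEdge {b} {d} unique b~d cover =
      let e , e∉ , b~e = neighbourOutside (c ∷ b ∷ d ∷ []) (there (here refl))
      in Sn4-fromStar (Unique-∷ʳ unique e∉) b~d b~e (widen _ cover)

    Sn4-fromVertex : ∀ {b} → Unique (c ∷ b ∷ []) → Covers (b ∷ []) → Sn4 n ⊆G H
    Sn4-fromVertex {b} unique cover =
      let d , d∉ , b~d = neighbourOutside (c ∷ b ∷ []) (there (here refl))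
      in Sn4-fromEdge (Unique-∷ʳ unique d∉) b~d (widen _ cover)

    Sn4⊆H : ∀ {xs} → NonNeighbourhood c xs → ¬ Cherry c → Sn4 n ⊆G H
    Sn4⊆H {[]} N _ =
      let b , b∉ , _ = neighbourOutside (c ∷ []) (here refl)
      in Sn4-fromVertex (Unique-∷ʳ ([] ∷ []) b∉) (λ c≁u → contradiction (NonNeighbourhood.complete N c≁u) λ ())
    Sn4⊆H {_ ∷ []} N _ = Sn4-fromVertex (withCentre N) (NonNeighbourhood.complete N)
    Sn4⊆H {x ∷ y ∷ []} N@record { nonadjacent = c≁x ∷ c≁y ∷ [] ; complete = cover } _ with adj H x y in x~y
    ... | true = Sn4-fromEdge (withCentre N) x~y cover
    ... | false =
      let b , b∉ , x~b , y~b = commonNeighbourOutside (c ∷ x ∷ y ∷ []) (c ∷ []) (c ∷ [])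
                                 (there (here refl) ∷ here refl ∷ []) ([] ∷ []) (≁-sym c≁x ∷ [])
                                 (there (there (here refl)) ∷ here refl ∷ []) ([] ∷ []) (≁-sym c≁y ∷ [])
      in Sn4-fromStar (Unique-insert (withCentre N) b∉) (~-sym x~b) (~-sym y~b) (there ∘ cover)
    Sn4⊆H {_ ∷ _ ∷ _ ∷ []} N noCherry =
      let _ , _ , _ , N′ , a~b , a~d = centreOfTriple N noCherry
      in Sn4-fromStar (withCentre N′) a~b a~d (NonNeighbourhood.complete N′)
    Sn4⊆H {_ ∷ _ ∷ _ ∷ _ ∷ _} N _ = tooManyNonNeighbours N

    TA-fromHead : ∀ {x y z w} → NonNeighbourhood c (y ∷ z ∷ w ∷ []) → c ~ x → y ~ w → y ~ x → z ~ x → TA n ⊆G H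
    TA-fromHead N c~x y~w y~x z~x =
      TA-embedding (Unique-insert (withCentre N) (adjacent∉ (NonNeighbourhood.nonadjacent N) c~x))
                   c~x (~-sym y~x) (~-sym z~x) y~w (NonNeighbourhood.complete N)

    TA-findW : ∀ {x y z} → Unique (c ∷ x ∷ y ∷ z ∷ []) → c ~ x → x ~ y → x ~ z → Covers (y ∷ z ∷ []) → TA n ⊆G H
    TA-findW {x} {y} {z} unique c~x x~y x~z cover =
      let w , w∉ , y~w = neighbourOutside (c ∷ x ∷ y ∷ z ∷ []) (there (there (here refl)))
      in TA-embedding (Unique-∷ʳ unique w∉) c~x x~y x~z y~w (widen _ cover)

    TA-findZ : ∀ {x y} → Unique (c ∷ x ∷ y ∷ []) → c ~ x → x ~ y → Covers (y ∷ []) → TA n ⊆G H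
    TA-findZ {x} {y} unique c~x x~y cover =
      let z , z∉ , x~z = neighbourOutside (c ∷ x ∷ y ∷ []) (there (here refl))
      in TA-findW (Unique-∷ʳ unique z∉) c~x x~y x~z (widen _ cover)

    TA-fromVertex : ∀ {y} → Unique (c ∷ y ∷ []) → Covers (y ∷ []) → TA n ⊆G H
    TA-fromVertex {y} unique cover =
      let x , x∉ , y~x = neighbourOutside (c ∷ y ∷ []) (there (here refl))
      in TA-findZ (Unique-insert unique x∉) (adjacentToCentre cover x∉) (~-sym y~x) cover

    -- The neighbour x₀ of a found first is adjacent to b or to d, or else b and d have a further
    -- common non-neighbour x₀ and hence a common neighbour outside.
    TA-fromTriangle : ∀ {a b d} → NonNeighbourhood c (a ∷ b ∷ d ∷ []) → a ~ b → a ~ d → b ~ d → TA n ⊆G H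
    TA-fromTriangle {a} {b} {d} N@record { nonadjacent = _ ∷ c≁b ∷ c≁d ∷ [] ; complete = complete } a~b a~d b~d =
      continue (adj H b x₀) refl (adj H d x₀) refl
      where
      found = neighbourOutside (c ∷ a ∷ b ∷ d ∷ []) (there (here refl))
      x₀ = proj₁ found
      x₀∉ = proj₁ (proj₂ found)
      a~x₀ = proj₂ (proj₂ found)
      c~x₀ = adjacentToCentre complete x₀∉
      continue : ∀ β → adj H b x₀ ≡ β → ∀ δ → adj H d x₀ ≡ δ → TA n ⊆G H
      continue true b~x₀ _ _ = TA-fromHead N c~x₀ a~d a~x₀ b~x₀
      continue false _ true d~x₀ = TA-fromHead (NonNeighbourhood-resp-↭ (prep a (swap b d ↭-refl)) N) c~x₀ a~b a~x₀ d~x₀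
      continue false nonadj-b false nonadj-d =
        let c≢x₀ = λ c≡x₀ → x₀∉ (here (sym c≡x₀))
            b≢x₀ = λ b≡x₀ → x₀∉ (there (there (here (sym b≡x₀))))
            d≢x₀ = λ d≡x₀ → x₀∉ (there (there (there (here (sym d≡x₀)))))
            x₁ , x₁∉ , b~x₁ , d~x₁ = commonNeighbourOutside (c ∷ a ∷ b ∷ d ∷ x₀ ∷ []) (c ∷ x₀ ∷ []) (c ∷ x₀ ∷ [])
              (there (there (here refl)) ∷ here refl ∷ there (there (there (there (here refl)))) ∷ [])
              ((c≢x₀ ∷ []) ∷ [] ∷ []) (≁-sym c≁b ∷ (nonadj-b , b≢x₀) ∷ [])
              (there (there (there (here refl))) ∷ here refl ∷ there (there (there (there (here refl)))) ∷ [])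
              ((c≢x₀ ∷ []) ∷ [] ∷ []) (≁-sym c≁d ∷ (nonadj-d , d≢x₀) ∷ [])
        in TA-fromHead (NonNeighbourhood-resp-↭ (↭-trans (swap a b ↭-refl) (prep b (swap a d ↭-refl))) N)
                       (adjacentToCentre complete (x₁∉ ∘ xs⊆xs++ys (c ∷ a ∷ b ∷ d ∷ []) (x₀ ∷ [])))
                       (~-sym a~b) b~x₁ d~x₁

    TA⊆H : ∀ {xs} → NonNeighbourhood c xs → ¬ Cherry c → TA n ⊆G H
    TA⊆H {[]} N _ =
      let y , y∉ , _ = neighbourOutside (c ∷ []) (here refl)
      in TA-fromVertex (Unique-∷ʳ ([] ∷ []) y∉) (λ c≁u → contradiction (NonNeighbourhood.complete N c≁u) λ ())
    TA⊆H {_ ∷ []} N _ = TA-fromVertex (withCentre N) (NonNeighbourhood.complete N)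
    TA⊆H {s ∷ t ∷ []} N@record { nonadjacent = c≁s ∷ c≁t ∷ [] ; complete = cover } _ =
      let x , x∉ , s~x , t~x = commonNeighbourOutside (c ∷ s ∷ t ∷ []) (c ∷ []) (c ∷ [])
                                 (there (here refl) ∷ here refl ∷ []) ([] ∷ []) (≁-sym c≁s ∷ [])
                                 (there (there (here refl)) ∷ here refl ∷ []) ([] ∷ []) (≁-sym c≁t ∷ [])
      in TA-findW (Unique-insert (withCentre N) x∉) (adjacentToCentre cover x∉) (~-sym s~x) (~-sym t~x) cover
    TA⊆H {_ ∷ _ ∷ _ ∷ []} N noCherry with centreOfTriple N noCherry
    ... | a , b , d , N′ , a~b , a~d with adj H b d in b~d
    ...   | true = TA-fromTriangle N′ a~b a~d b~d
    ...   | false with N′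
    ...     | record { unique = _ ∷ (b≢d ∷ []) ∷ [] ∷ [] ; nonadjacent = c≁a ∷ c≁b ∷ c≁d ∷ [] ; complete = cover } =
      let x , x∉ , a~x , b~x = commonNeighbourOutside (c ∷ a ∷ b ∷ d ∷ []) (c ∷ []) (c ∷ d ∷ [])
                                 (there (here refl) ∷ here refl ∷ []) ([] ∷ []) (≁-sym c≁a ∷ [])
                                 (there (there (here refl)) ∷ here refl ∷ there (there (there (here refl))) ∷ [])
                                 ((proj₂ c≁d ∷ []) ∷ [] ∷ []) (≁-sym c≁b ∷ (b~d , b≢d) ∷ [])
      in TA-fromHead N′ (adjacentToCentre cover x∉) a~d a~x b~x
    TA⊆H {_ ∷ _ ∷ _ ∷ _ ∷ _} N _ = tooManyNonNeighbours N

  atMostThree : ∀ {v a b d} u → Unique (a ∷ b ∷ d ∷ []) → All (v ≁_) (a ∷ b ∷ d ∷ []) → v ≁ u → u ∈ a ∷ b ∷ d ∷ []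
  atMostThree {a = a} {b} {d} u unique v≁abd v≁u with u ∈? (a ∷ b ∷ d ∷ [])
  ... | yes u∈ = u∈
  ... | no u∉ = contradiction (≁-neighbours≤3 (¬Any⇒All¬ _ u∉ ∷ unique) (v≁u ∷ v≁abd)) λ { (s≤s (s≤s (s≤s ()))) }

  coveredByCherry : ∀ {v x y z} → v ≁ x → v ≁ y → v ≁ z → x ≁ y → y ≁ z → x ≢ z → ∀ {u} → v ≁ u → u ∈ x ∷ y ∷ z ∷ []
  coveredByCherry v≁x v≁y v≁z (_ , x≢y) (_ , y≢z) x≢z =
    atMostThree _ ((x≢y ∷ x≢z ∷ []) ∷ (y≢z ∷ []) ∷ [] ∷ []) (v≁x ∷ v≁y ∷ v≁z ∷ [])

  -- If x ~ z, the only non-adjacent pair among the non-neighbours of x is {v, y}, so a cherry at x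
  -- would have equal ends.
  cherry⇒≁ : ∀ {v x y z} → v ≁ x → v ≁ y → v ≁ z → x ≁ y → y ≁ z → x ≢ z → Cherry x → x ≁ z
  cherry⇒≁ {v} {x} {y} {z} v≁x v≁y v≁z x≁y y≁z x≢z (x₁ , y₁ , z₁ , x≁x₁ , x≁y₁ , x≁z₁ , x₁≁y₁ , y₁≁z₁ , x₁≢z₁)
    with adj H x z in x~z
  ... | false = refl , x≢z
  ... | true = contradiction (ends (pair x≁x₁ x≁y₁ x₁≁y₁) (pair x≁y₁ x≁z₁ y₁≁z₁)) x₁≢z₁
    where
    v≢y = proj₂ v≁y
    N[v] : ∀ {u} → v ≁ u → u ∈ x ∷ y ∷ z ∷ []
    N[v] = coveredByCherry v≁x v≁y v≁z x≁y y≁z x≢z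
    N[y] : ∀ {u} → y ≁ u → u ∈ v ∷ x ∷ z ∷ []
    N[y] = atMostThree _ ((proj₂ v≁x ∷ proj₂ v≁z ∷ []) ∷ (x≢z ∷ []) ∷ [] ∷ []) (≁-sym v≁y ∷ ≁-sym x≁y ∷ y≁z ∷ [])
    onlyY : ∀ {u} → x ≁ u → u ∈ x ∷ y ∷ z ∷ [] → u ≡ y
    onlyY (_ , x≢x) (here refl) = contradiction refl x≢x
    onlyY _ (there (here refl)) = refl
    onlyY (x≁z , _) (there (there (here refl))) = contradiction (trans (sym x~z) x≁z) λ ()
    onlyV : ∀ {u} → x ≁ u → u ∈ v ∷ x ∷ z ∷ [] → u ≡ v
    onlyV _ (here refl) = refl
    onlyV (_ , x≢x) (there (here refl)) = contradiction refl x≢x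
    onlyV (x≁z , _) (there (there (here refl))) = contradiction (trans (sym x~z) x≁z) λ ()
    pair : ∀ {a b} → x ≁ a → x ≁ b → a ≁ b → (a ≡ v × b ≡ y) ⊎ (a ≡ y × b ≡ v)
    pair {a} {b} x≁a x≁b a≁b with a ≟ v | a ≟ y | b ≟ v | b ≟ y
    ... | yes refl | _ | _ | _ = inj₁ (refl , onlyY x≁b (N[v] a≁b))
    ... | no _ | yes refl | _ | _ = inj₂ (refl , onlyV x≁b (N[y] a≁b))
    ... | no _ | no a≢y | yes refl | _ = contradiction (onlyY x≁a (N[v] (≁-sym a≁b))) a≢y
    ... | no a≢v | no _ | no _ | yes refl = contradiction (onlyV x≁a (N[y] (≁-sym a≁b))) a≢v
    ... | no a≢v | no a≢y | no b≢v | no b≢y =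
      contradiction (≁-neighbours≤3 ((v≢y ∷ ≢-sym a≢v ∷ ≢-sym b≢v ∷ []) ∷ (≢-sym a≢y ∷ ≢-sym b≢y ∷ [])
                                       ∷ (proj₂ a≁b ∷ []) ∷ [] ∷ [])
                                    (≁-sym v≁x ∷ x≁y ∷ x≁a ∷ x≁b ∷ [])) λ { (s≤s (s≤s (s≤s ()))) }
    ends : (x₁ ≡ v × y₁ ≡ y) ⊎ (x₁ ≡ y × y₁ ≡ v) → (y₁ ≡ v × z₁ ≡ y) ⊎ (y₁ ≡ y × z₁ ≡ v) → x₁ ≡ z₁
    ends (inj₁ (refl , refl)) (inj₁ (y≡v , _)) = contradiction (sym y≡v) v≢y
    ends (inj₁ (refl , refl)) (inj₂ (_ , refl)) = refl
    ends (inj₂ (refl , refl)) (inj₁ (_ , refl)) = refl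
    ends (inj₂ (refl , refl)) (inj₂ (v≡y , _)) = contradiction v≡y v≢y

  nonNeighbours-nonadjacent : (∀ v → Cherry v) → ∀ {v p q} → v ≁ p → v ≁ q → p ≢ q → p ≁ q
  nonNeighbours-nonadjacent cherries {v} v≁p v≁q p≢q with cherries v
  ... | x , y , z , v≁x , v≁y , v≁z , x≁y , y≁z , x≢z =
    AllPairs-lookup ≁-sym ((x≁y ∷ x≁z ∷ []) ∷ (y≁z ∷ []) ∷ [] ∷ []) (N[v] v≁p) (N[v] v≁q) p≢q
    where
    x≁z = cherry⇒≁ v≁x v≁y v≁z x≁y y≁z x≢z (cherries x)
    N[v] = coveredByCherry v≁x v≁y v≁z x≁y y≁z x≢z

  complement≅kK4 : (∀ v → Cherry v) → (n % 4 ≡ 0) × (complement H ≅ kK4 (n / 4))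
  complement≅kK4 cherries = n%m≡0 , ψ , λ u v →
    trans (cong₂ _∧_ (neqF-injective (Injection.injective (↔⇒↣ ψ)) u v) (blocks u v)) (∧-comm (neqF u v) (R u v))
    where
    R : Fin n → Fin n → Bool
    R u v = not (adj H u v)
    R-refl : ∀ v → R v v ≡ true
    R-refl v = cong not (irrefl H v)
    R-sym : ∀ {u v} → R u v ≡ true → R v u ≡ true
    R-sym {u} {v} = trans (cong not (Graph.sym H v u))
    R-trans : ∀ {u v w} → R u v ≡ true → R v w ≡ true → R u w ≡ true
    R-trans {u} {v} {w} uRv vRw with u ≟ v | v ≟ w | u ≟ w
    ... | yes refl | _ | _ = vRw
    ... | no _ | yes refl | _ = uRv
    ... | no _ | no _ | yes refl = R-refl u
    ... | no u≢v | no v≢w | no u≢w =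
      cong not (proj₁ (nonNeighbours-nonadjacent cherries (≁-sym (not-injective uRv , u≢v)) (not-injective vRw , v≢w) u≢w))
    R-size : ∀ v → count (R v) ≡ 4
    R-size v with cherries v
    ... | x , y , z , (v≁x , v≢x) , (v≁y , v≢y) , (v≁z , v≢z) , (_ , x≢y) , (_ , y≢z) , x≢z =
      ≤-antisym (nonNeighbours≤4 v)
                (length≤count ((v≢x ∷ v≢y ∷ v≢z ∷ []) ∷ (x≢y ∷ x≢z ∷ []) ∷ (y≢z ∷ []) ∷ [] ∷ [])
                              (R-refl v ∷ cong not v≁x ∷ cong not v≁y ∷ cong not v≁z ∷ []))
    open Blocks R R-refl R-sym R-trans R-size using (n%m≡0; blockIsomorphism)
    ψ = proj₁ blockIsomorphism
    blocks = proj₂ blockIsomorphism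

lemma7 : (n : ℕ) → 8 ≤ n → (H : Graph n) → minDeg≥ H (n ∸ 4) →
    ((Sn4 n ⊆G H) × (TA n ⊆G H)) ⊎ ((n % 4 ≡ 0) × (complement H ≅ kK4 (n / 4)))
lemma7 n 8≤n H δ with any? (λ c → ¬? (NonAdjacency.cherry? H c))
... | yes (c , noCherry) = inj₁ (Sn4⊆H N noCherry , TA⊆H N noCherry)
  where
  open Search H 8≤n δ
  open Centred c
  N = proj₂ (NonAdjacency.nonNeighbourhood H c)
... | no everyHasCherry =
  inj₂ (complement≅kK4 λ v → decidable-stable (NonAdjacency.cherry? H v) λ noCherry → everyHasCherry (v , noCherry))
  where open Search H 8≤n δ
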